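{- Let $D$ be a graph with $D\in\mathcal{U}$. Then for every $S\subset V(D)$, $|S|\le|N(S)|$.
   Context: A graph is a symmetric digraph (loops allowed). $D\in\mathcal{U}$ means there is a unitary matrix $U$, indexed by the vertices, with $U_{v,w}\neq0$ iff $(v,w)$ is an arc. For $S\subset V(D)$, $N(S)=\{w: (v,w)\text{ is an arc for some } v\in S\}$. -}

module Defs where

open import Level using (Level; _⊔_)
open import Data.Nat using (ℕ; zero; suc)
open import Data.Fin using (Fin; zero; suc)
open import Data.Bool using (Bool; true; false; _∧_)
open import Data.List using (allFin)
open import Data.Bool.ListAction using (any)
open import Data.Vec using (tabulate)
open import Data.Fin.Subset using (Subset)
open import Relation.Binary.PropositionalEquality using (_≡_)
open import Relation.Nullary using (¬_)
open import Function.Bundles using (_⇔_)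
open import Algebra.Bundles using (CommutativeRing)
open import Data.Product using () renaming (Σ to Σ'; _×_ to _×'_)

-- A commutative ring with an involution * (conjugation), x ↦ x*, that is a
-- ring automorphism of order 2, and with 1 ≉ 0.  ℂ with complex conjugation
-- is the motivating instance.
record StarRing (c ℓ : Level) : Set (Level.suc (c ⊔ ℓ)) where
  field
    commRing : CommutativeRing c ℓ
  open CommutativeRing commRing public
  field
    conj        : Carrier → Carrier
    conj-cong   : ∀ {x y} → x ≈ y → conj x ≈ conj y
    conj-+      : ∀ x y → conj (x + y) ≈ conj x + conj y
    conj-*      : ∀ x y → conj (x * y) ≈ conj x * conj y
    conj-1      : conj 1# ≈ 1#
    conj-invol  : ∀ x → conj (conj x) ≈ x
    nontrivial  : ¬ (1# ≈ 0#)

module _ {c ℓ : Level} (R : StarRing c ℓ) where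
  open StarRing R using (Carrier; _≈_; _+_; _*_; 0#; 1#; conj)

  sumFin : (n : ℕ) → (Fin n → Carrier) → Carrier
  sumFin zero    f = 0#
  sumFin (suc n) f = f zero + sumFin n (λ k → f (suc k))

  δ : {n : ℕ} → Fin n → Fin n → Carrier
  δ zero    zero    = 1#
  δ zero    (suc j) = 0#
  δ (suc i) zero    = 0#
  δ (suc i) (suc j) = δ i j

  IsUnitary : {n : ℕ} → (Fin n → Fin n → Carrier) → Set ℓ
  IsUnitary {n} U =
    (∀ i j → sumFin n (λ k → U i k * conj (U j k)) ≈ δ i j) ×'
    (∀ i j → sumFin n (λ k → conj (U k i) * U k j) ≈ δ i j)

  InU : {n : ℕ} → (Fin n → Fin n → Bool) → Set (c ⊔ ℓ)
  InU {n} A = Σ' (Fin n → Fin n → Carrier) λ U →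
    IsUnitary U ×' (∀ v w → (¬ (U v w ≈ 0#)) ⇔ (A v w ≡ true))

-- A graph on vertex set Fin n: arc relation A v w ≡ true, symmetric, loops allowed.
Symmetric : {n : ℕ} → (Fin n → Fin n → Bool) → Set
Symmetric A = ∀ v w → A v w ≡ A w v

N : {n : ℕ} → (Fin n → Fin n → Bool) → Subset n → Subset n
N {n} A S = tabulate (λ w → any (λ v → Data.Vec.lookup S v ∧ A v w) (allFin n))
  where import Data.Vec

{-# OPTIONS --safe #-}
-- If |N(S)| < |S|, the rows of U indexed by S are orthonormal and supported in the
-- columns N(S), so they factor the identity matrix on S as M M* through fewer than |S|
-- coordinates.  Over a nontrivial commutative ring this is impossible: expanding
-- det (M M*) as in the Cauchy–Binet formula writes det I = 1 as a combination of
-- determinants of matrices whose |S| rows are drawn from fewer than |S| rows of M*;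
-- by the pigeonhole principle each has two equal rows, hence vanishes.
module Submission where

open import Defs
open import Level using (Level)
open import Data.Nat using (ℕ; _≤_)
open import Data.Fin using (Fin)
open import Data.Bool using (Bool)
open import Data.Fin.Subset using (Subset; ∣_∣)

open import Algebra.Bundles using (Monoid; CommutativeRing)
open import Data.Bool using (true; false; _∧_)
open import Data.Bool.ListAction using (any)
open import Data.Bool.Properties using (T-≡)
open import Data.Empty using (⊥-elim)
open import Data.Fin using (zero; suc; punchIn; punchOut)
open import Data.Fin.Properties using (pigeonhole; <⇒≢; punchIn-punchOut; ∀-cons)
open import Data.Fin.Subset using (_∈_; _∉_)
open import Data.Fin.Subset.Properties using (drop-there)
open import Data.List using () renaming (allFin to allFinᴸ)
open import Data.List.Membership.Propositional using (lose)
open import Data.List.Membership.Propositional.Properties using (∈-allFin)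
open import Data.List.Relation.Unary.Any.Properties using (any⁺)
open import Data.Nat using (zero; suc; _<_; _≤?_)
open import Data.Nat.Properties using (≮⇒≥)
open import Data.Product using (_,_)
open import Data.Vec using (Vec; []; _∷_; here; there; lookup; insertAt; map; allFin)
open import Data.Vec.Properties
  using (insertAt-lookup; insertAt-punchIn; lookup-map; lookup-allFin; tabulate-∘;
         lookup∘tabulate; []=⇒lookup; lookup⇒[]=)
open import Function using (id; _∘_; Equivalence)
open import Relation.Binary.PropositionalEquality as ≡ using (_≡_; _≢_; cong; cong₂)
open import Relation.Nullary using (¬_; contradiction)
open import Relation.Nullary.Decidable using (decidable-stable)
open import Relation.Nullary.Negation using (¬¬-map)

element : ∀ {n} (S : Subset n) → Fin ∣ S ∣ → Fin n
element (true  ∷ S) zero    = zero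
element (true  ∷ S) (suc a) = suc (element S a)
element (false ∷ S) a       = suc (element S a)

element-∈ : ∀ {n} (S : Subset n) a → element S a ∈ S
element-∈ (true  ∷ S) zero    = here
element-∈ (true  ∷ S) (suc a) = there (element-∈ S a)
element-∈ (false ∷ S) a       = there (element-∈ S a)

module _ {c ℓ} (M : Monoid c ℓ) where
  open Monoid M
  open import Algebra.Properties.Monoid.Sum M using (sum)

  ∑-restrict : ∀ {n} (S : Subset n) (f : Fin n → Carrier) → (∀ w → w ∉ S → f w ≈ ε) →
               sum f ≈ sum (f ∘ element S)
  ∑-restrict []          f f≈ε = refl
  ∑-restrict (true  ∷ S) f f≈ε =
    ∙-congˡ (∑-restrict S (f ∘ suc) (λ w w∉S → f≈ε (suc w) (w∉S ∘ drop-there)))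
  ∑-restrict (false ∷ S) f f≈ε = trans
    (∙-cong (f≈ε zero λ ()) (∑-restrict S (f ∘ suc) (λ w w∉S → f≈ε (suc w) (w∉S ∘ drop-there))))
    (identityˡ _)

module Determinant {c ℓ} (R : CommutativeRing c ℓ) where
  open CommutativeRing R hiding (zero)
  open import Algebra.Properties.Ring ring using (-‿distribˡ-*; -0#≈0#; -‿involutive)
  open import Algebra.Properties.Semiring.Sum semiring
    using (sum; sum-syntax; ∑-distrib-+; ∑-comm; sum-cong-≋; sum-replicate-zero;
           *-distribˡ-sum; *-distribʳ-sum)
  open import Algebra.Properties.CommutativeMonoid.Sum *-commutativeMonoid
    using () renaming (sum to ∏; sum-cong-≋ to ∏-cong; sum-remove to ∏-remove;
                       ∑-distrib-+ to ∏-distrib-*; sum-replicate-zero to ∏-replicate-1)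
  open import Algebra.Solver.CommutativeMonoid *-commutativeMonoid using (solve; _⊜_; _⊕_)
  open import Relation.Binary.Reasoning.Setoid setoid

  Matrix : ℕ → ℕ → Set c
  Matrix m n = Fin m → Fin n → Carrier

  identity : ∀ {n} → Matrix n n
  identity zero    zero    = 1#
  identity zero    (suc _) = 0#
  identity (suc _) zero    = 0#
  identity (suc i) (suc j) = identity i j

  infixl 7 _·_
  _·_ : ∀ {k m n} → Matrix k m → Matrix m n → Matrix k n
  _·_ {m = m} A B a b = ∑[ w < m ] (A a w * B w b)

  identity-element : ∀ {n} (S : Subset n) a b → identity (element S a) (element S b) ≡ identity a b
  identity-element (true  ∷ S) zero    zero    = ≡.refl
  identity-element (true  ∷ S) zero    (suc b) = ≡.refl
  identity-element (true  ∷ S) (suc a) zero    = ≡.refl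
  identity-element (true  ∷ S) (suc a) (suc b) = identity-element S a b
  identity-element (false ∷ S) a       b       = identity-element S a b

  ∑-zero : ∀ {n} {f : Fin n → Carrier} → (∀ i → f i ≈ 0#) → sum f ≈ 0#
  ∑-zero {n} f≈0 = trans (sum-cong-≋ {n} f≈0) (sum-replicate-zero n)

  ∑-identity : ∀ {n} (a : Fin n) (ψ : Fin n → Carrier) → sum (λ j → identity a j * ψ j) ≈ ψ a
  ∑-identity {suc n} zero ψ = begin
    1# * ψ zero + ∑[ j < n ] (0# * ψ (suc j))
      ≈⟨ +-cong (*-identityˡ _) (∑-zero (λ j → zeroˡ (ψ (suc j)))) ⟩
    ψ zero + 0#
      ≈⟨ +-identityʳ _ ⟩
    ψ zero ∎
  ∑-identity {suc n} (suc a) ψ = begin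
    0# * ψ zero + ∑[ j < n ] (identity a j * ψ (suc j))
      ≈⟨ +-cong (zeroˡ _) (∑-identity a (ψ ∘ suc)) ⟩
    0# + ψ (suc a)
      ≈⟨ +-identityˡ _ ⟩
    ψ (suc a) ∎

  ∑∑-alternating≈0 : ∀ {n} (H : Matrix n n) → (∀ a → H a a ≈ 0#) → (∀ a b → H a b + H b a ≈ 0#) →
                     ∑[ a < n ] ∑[ b < n ] H a b ≈ 0#
  ∑∑-alternating≈0 {zero}  H Hₐₐ≈0 Hₐᵦ+Hᵦₐ≈0 = refl
  ∑∑-alternating≈0 {suc n} H Hₐₐ≈0 Hₐᵦ+Hᵦₐ≈0 = begin
    (H zero zero + X) + ∑[ a < n ] (H (suc a) zero + ∑[ b < n ] H (suc a) (suc b))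
      ≈⟨ +-cong (+-congʳ (Hₐₐ≈0 zero)) (∑-distrib-+ {n} _ _) ⟩
    (0# + X) + (Y + ∑[ a < n ] ∑[ b < n ] H (suc a) (suc b))
      ≈⟨ +-cong (+-identityˡ X) (+-congˡ (∑∑-alternating≈0 (λ a b → H (suc a) (suc b))
                                            (Hₐₐ≈0 ∘ suc) (λ a b → Hₐᵦ+Hᵦₐ≈0 (suc a) (suc b)))) ⟩
    X + (Y + 0#)
      ≈⟨ +-congˡ (+-identityʳ Y) ⟩
    X + Y
      ≈⟨ sym (∑-distrib-+ {n} _ _) ⟩
    ∑[ b < n ] (H zero (suc b) + H (suc b) zero)
      ≈⟨ ∑-zero (λ b → Hₐᵦ+Hᵦₐ≈0 zero (suc b)) ⟩
    0# ∎
    where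
    X = ∑[ b < n ] H zero (suc b)
    Y = ∑[ a < n ] H (suc a) zero

  ∑ᵛ : ∀ k {n} → (Vec (Fin n) k → Carrier) → Carrier
  ∑ᵛ zero    F = F []
  ∑ᵛ (suc k) {n} F = ∑[ j < n ] ∑ᵛ k (λ g → F (j ∷ g))

  ∑ᵛ-cong : ∀ k {n} {F G : Vec (Fin n) k → Carrier} → (∀ g → F g ≈ G g) → ∑ᵛ k F ≈ ∑ᵛ k G
  ∑ᵛ-cong zero    F≈G = F≈G []
  ∑ᵛ-cong (suc k) {n} F≈G = sum-cong-≋ {n} (λ j → ∑ᵛ-cong k (λ g → F≈G (j ∷ g)))

  ∑ᵛ-zero : ∀ k {n} {F : Vec (Fin n) k → Carrier} → (∀ g → F g ≈ 0#) → ∑ᵛ k F ≈ 0#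
  ∑ᵛ-zero zero    F≈0 = F≈0 []
  ∑ᵛ-zero (suc k) F≈0 = ∑-zero (λ j → ∑ᵛ-zero k (λ g → F≈0 (j ∷ g)))

  ∑ᵛ-distrib-+ : ∀ k {n} (F G : Vec (Fin n) k → Carrier) → ∑ᵛ k (λ g → F g + G g) ≈ ∑ᵛ k F + ∑ᵛ k G
  ∑ᵛ-distrib-+ zero    F G = refl
  ∑ᵛ-distrib-+ (suc k) {n} F G =
    trans (sum-cong-≋ {n} (λ j → ∑ᵛ-distrib-+ k _ _)) (∑-distrib-+ {n} _ _)

  *-distribˡ-∑ᵛ : ∀ k {n} x (F : Vec (Fin n) k → Carrier) → x * ∑ᵛ k F ≈ ∑ᵛ k (λ g → x * F g)
  *-distribˡ-∑ᵛ zero    x F = refl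
  *-distribˡ-∑ᵛ (suc k) {n} x F =
    trans (*-distribˡ-sum {n} x _) (sum-cong-≋ {n} (λ j → *-distribˡ-∑ᵛ k x _))

  ∑-∑ᵛ-comm : ∀ {m} k {n} (F : Fin m → Vec (Fin n) k → Carrier) →
              ∑[ j < m ] ∑ᵛ k (F j) ≈ ∑ᵛ k (λ g → ∑[ j < m ] F j g)
  ∑-∑ᵛ-comm zero    F = refl
  ∑-∑ᵛ-comm {m} (suc k) {n} F =
    trans (∑-comm {m} {n} _) (sum-cong-≋ {n} (λ a → ∑-∑ᵛ-comm k (λ j g → F j (a ∷ g))))

  ∑ᵛ-comm : ∀ k l {m n} (F : Vec (Fin m) k → Vec (Fin n) l → Carrier) →
            ∑ᵛ k (λ f → ∑ᵛ l (F f)) ≈ ∑ᵛ l (λ g → ∑ᵛ k (λ f → F f g))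
  ∑ᵛ-comm zero    l F = refl
  ∑ᵛ-comm (suc k) l {m} F =
    trans (sum-cong-≋ {m} (λ a → ∑ᵛ-comm k l (λ f → F (a ∷ f))))
          (∑-∑ᵛ-comm {m} l (λ j g → ∑ᵛ k (λ f → F (j ∷ f) g)))

  ∑ᵛ-insertAt : ∀ {k n} (p : Fin (suc k)) (F : Vec (Fin n) (suc k) → Carrier) →
                ∑ᵛ (suc k) F ≈ ∑[ a < n ] ∑ᵛ k (λ h → F (insertAt h p a))
  ∑ᵛ-insertAt zero F = refl
  ∑ᵛ-insertAt {suc k} {n} (suc p) F =
    trans (sum-cong-≋ {n} (λ x → ∑ᵛ-insertAt p (λ v → F (x ∷ v)))) (∑-comm {n} {n} _)

  ∏-∑-distrib : ∀ k {n} (Y : Matrix k n) →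
                ∏ (λ a → ∑[ w < n ] Y a w) ≈ ∑ᵛ k (λ g → ∏ (λ a → Y a (lookup g a)))
  ∏-∑-distrib zero    Y = refl
  ∏-∑-distrib (suc k) {n} Y = begin
    (∑[ w < n ] Y zero w) * ∏ (λ a → ∑[ w < n ] Y (suc a) w)
      ≈⟨ *-congˡ (∏-∑-distrib k (Y ∘ suc)) ⟩
    (∑[ w < n ] Y zero w) * ∑ᵛ k (λ g → ∏ (λ a → Y (suc a) (lookup g a)))
      ≈⟨ *-distribʳ-sum {n} _ _ ⟩
    ∑[ j < n ] (Y zero j * ∑ᵛ k (λ g → ∏ (λ a → Y (suc a) (lookup g a))))
      ≈⟨ sum-cong-≋ {n} (λ j → *-distribˡ-∑ᵛ k _ _) ⟩
    ∑ᵛ (suc k) (λ g → ∏ (λ a → Y a (lookup g a))) ∎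

  ∑ᵛ-identity : ∀ {k n} (c : Vec (Fin n) k) (φ : Vec (Fin n) k → Carrier) →
                ∑ᵛ k (λ f → ∏ (λ i → identity (lookup c i) (lookup f i)) * φ f) ≈ φ c
  ∑ᵛ-identity []       φ = *-identityˡ _
  ∑ᵛ-identity {suc k} {n} (c ∷ cs) φ = begin
    ∑[ j < n ] ∑ᵛ k (λ h → identity c j * ∏ (λ i → identity (lookup cs i) (lookup h i)) * φ (j ∷ h))
      ≈⟨ sum-cong-≋ {n} (λ j → trans (∑ᵛ-cong k (λ h → *-assoc _ _ _))
                                      (sym (*-distribˡ-∑ᵛ k _ _))) ⟩
    ∑[ j < n ] (identity c j * ∑ᵛ k (λ h → ∏ (λ i → identity (lookup cs i) (lookup h i)) * φ (j ∷ h)))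
      ≈⟨ sum-cong-≋ {n} (λ j → *-congˡ (∑ᵛ-identity cs (λ h → φ (j ∷ h)))) ⟩
    ∑[ j < n ] (identity c j * φ (j ∷ cs))
      ≈⟨ ∑-identity c (λ j → φ (j ∷ cs)) ⟩
    φ (c ∷ cs) ∎

  ∏-insertAt : ∀ {A : Set} {k} (G : Fin (suc k) → A → Carrier) (h : Vec A k) p a →
               ∏ (λ r → G r (lookup (insertAt h p a) r)) ≈ G p a * ∏ (λ r → G (punchIn p r) (lookup h r))
  ∏-insertAt {k = k} G h p a = trans
    (∏-remove {k} {p} (λ r → G r (lookup (insertAt h p a) r)))
    (*-cong (reflexive (cong (G p) (insertAt-lookup h p a)))
            (∏-cong (λ r → reflexive (cong (G (punchIn p r)) (insertAt-punchIn h p a r)))))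

  ∏-insertAt₂ : ∀ {A : Set} {k} (G : Fin (suc (suc k)) → A → Carrier) (h : Vec A k) i j a b →
                ∏ (λ r → G r (lookup (insertAt (insertAt h j b) i a) r)) ≈
                G i a * (G (punchIn i j) b * ∏ (λ r → G (punchIn i (punchIn j r)) (lookup h r)))
  ∏-insertAt₂ G h i j a b =
    trans (∏-insertAt G (insertAt h j b) i a) (*-congˡ (∏-insertAt (G ∘ punchIn i) h j b))

  ∏-insertAt₂-swap : ∀ {A : Set} {k} (G : Fin (suc (suc k)) → A → Carrier) (h : Vec A k) i j a b →
                     (∀ x → G i x ≈ G (punchIn i j) x) →
                     ∏ (λ r → G r (lookup (insertAt (insertAt h j b) i a) r)) ≈
                     ∏ (λ r → G r (lookup (insertAt (insertAt h j a) i b) r))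
  ∏-insertAt₂-swap G h i j a b Gᵢ≈Gⱼ = begin
    ∏ (λ r → G r (lookup (insertAt (insertAt h j b) i a) r))
      ≈⟨ ∏-insertAt₂ G h i j a b ⟩
    G i a * (G j′ b * Q)
      ≈⟨ *-cong (Gᵢ≈Gⱼ a) (*-congʳ (sym (Gᵢ≈Gⱼ b))) ⟩
    G j′ a * (G i b * Q)
      ≈⟨ solve 3 (λ x y z → x ⊕ (y ⊕ z) ⊜ y ⊕ (x ⊕ z)) refl (G j′ a) (G i b) Q ⟩
    G i b * (G j′ a * Q)
      ≈⟨ sym (∏-insertAt₂ G h i j b a) ⟩
    ∏ (λ r → G r (lookup (insertAt (insertAt h j a) i b) r)) ∎
    where
    j′ = punchIn i j
    Q = ∏ (λ r → G (punchIn i (punchIn j r)) (lookup h r))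

  σ : ∀ {n} → Fin n → Fin n → Carrier
  σ zero    zero    = 0#
  σ zero    (suc _) = 1#
  σ (suc _) zero    = - 1#
  σ (suc a) (suc b) = σ a b

  σ-diag : ∀ {n} (a : Fin n) → σ a a ≈ 0#
  σ-diag zero    = refl
  σ-diag (suc a) = σ-diag a

  σ-antisym : ∀ {n} (a b : Fin n) → σ b a ≈ - σ a b
  σ-antisym zero    zero    = sym -0#≈0#
  σ-antisym zero    (suc b) = refl
  σ-antisym (suc a) zero    = sym (-‿involutive 1#)
  σ-antisym (suc a) (suc b) = σ-antisym a b

  Πσ : ∀ {n k} → Fin n → Vec (Fin n) k → Carrier
  Πσ a h = ∏ (λ r → σ a (lookup h r))

  -- ε v = ∏_{i<j} σ (v i) (v j): the sign of v when v is injective, and 0 otherwise.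
  ε : ∀ {n k} → Vec (Fin n) k → Carrier
  ε []      = 1#
  ε (a ∷ h) = Πσ a h * ε h

  sgn : ∀ {n} → Fin n → Carrier
  sgn zero    = 1#
  sgn (suc p) = - sgn p

  Πσ-insertAt : ∀ {n k} (x : Fin n) (h : Vec (Fin n) k) p a → Πσ x (insertAt h p a) ≈ σ x a * Πσ x h
  Πσ-insertAt x = ∏-insertAt (λ _ → σ x)

  ε-insertAt : ∀ {n k} (h : Vec (Fin n) k) p a → ε (insertAt h p a) ≈ sgn p * (Πσ a h * ε h)
  ε-insertAt h       zero    a = sym (*-identityˡ _)
  ε-insertAt (x ∷ h) (suc p) a = begin
    Πσ x (insertAt h p a) * ε (insertAt h p a)
      ≈⟨ *-cong (Πσ-insertAt x h p a) (ε-insertAt h p a) ⟩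
    σ x a * Πσ x h * (sgn p * (Πσ a h * ε h))
      ≈⟨ *-congʳ (*-congʳ (σ-antisym a x)) ⟩
    - σ a x * Πσ x h * (sgn p * (Πσ a h * ε h))
      ≈⟨ sym (*-congʳ (-‿distribˡ-* _ _)) ⟩
    - (σ a x * Πσ x h) * (sgn p * (Πσ a h * ε h))
      ≈⟨ sym (-‿distribˡ-* _ _) ⟩
    - (σ a x * Πσ x h * (sgn p * (Πσ a h * ε h)))
      ≈⟨ -‿cong (solve 5 (λ s x y z e → (x ⊕ y) ⊕ (s ⊕ (z ⊕ e)) ⊜ s ⊕ ((x ⊕ z) ⊕ (y ⊕ e)))
                        refl (sgn p) (σ a x) (Πσ x h) (Πσ a h) (ε h)) ⟩
    - (sgn p * (σ a x * Πσ a h * (Πσ x h * ε h)))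
      ≈⟨ -‿distribˡ-* _ _ ⟩
    - sgn p * (σ a x * Πσ a h * (Πσ x h * ε h)) ∎

  ε-insertAt₂ : ∀ {n k} (h : Vec (Fin n) k) i j a b →
                ε (insertAt (insertAt h j b) i a) ≈ σ a b * (sgn i * sgn j * (Πσ a h * Πσ b h * ε h))
  ε-insertAt₂ h i j a b = begin
    ε (insertAt (insertAt h j b) i a)
      ≈⟨ ε-insertAt _ i a ⟩
    sgn i * (Πσ a (insertAt h j b) * ε (insertAt h j b))
      ≈⟨ *-congˡ (*-cong (Πσ-insertAt a h j b) (ε-insertAt h j b)) ⟩
    sgn i * (σ a b * Πσ a h * (sgn j * (Πσ b h * ε h)))
      ≈⟨ solve 6 (λ s σ x t y e → s ⊕ ((σ ⊕ x) ⊕ (t ⊕ (y ⊕ e)))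
                                ⊜ σ ⊕ ((s ⊕ t) ⊕ ((x ⊕ y) ⊕ e)))
               refl (sgn i) (σ a b) (Πσ a h) (sgn j) (Πσ b h) (ε h) ⟩
    σ a b * (sgn i * sgn j * (Πσ a h * Πσ b h * ε h)) ∎

  ε-insertAt₂-diag : ∀ {n k} (h : Vec (Fin n) k) i j a → ε (insertAt (insertAt h j a) i a) ≈ 0#
  ε-insertAt₂-diag h i j a = trans (ε-insertAt₂ h i j a a) (trans (*-congʳ (σ-diag a)) (zeroˡ _))

  ε-insertAt₂-swap : ∀ {n k} (h : Vec (Fin n) k) i j a b →
                     ε (insertAt (insertAt h j b) i a) + ε (insertAt (insertAt h j a) i b) ≈ 0#
  ε-insertAt₂-swap h i j a b = begin
    ε (insertAt (insertAt h j b) i a) + ε (insertAt (insertAt h j a) i b)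
      ≈⟨ +-cong (ε-insertAt₂ h i j a b) (ε-insertAt₂ h i j b a) ⟩
    σ a b * C + σ b a * (sgn i * sgn j * (Πσ b h * Πσ a h * ε h))
      ≈⟨ +-congˡ (*-cong (σ-antisym a b) (*-congˡ (*-congʳ (*-comm _ _)))) ⟩
    σ a b * C + - σ a b * C
      ≈⟨ +-congˡ (sym (-‿distribˡ-* _ _)) ⟩
    σ a b * C + - (σ a b * C)
      ≈⟨ -‿inverseʳ _ ⟩
    0# ∎
    where C = sgn i * sgn j * (Πσ a h * Πσ b h * ε h)

  Πσ-zero-map-suc : ∀ {n k} (v : Vec (Fin n) k) → Πσ zero (map suc v) ≈ 1#
  Πσ-zero-map-suc {k = k} v =
    trans (∏-cong {k} (λ r → reflexive (cong (σ zero) (lookup-map r suc v)))) (∏-replicate-1 k)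

  ε-map-suc : ∀ {n k} (v : Vec (Fin n) k) → ε (map suc v) ≈ ε v
  ε-map-suc []      = refl
  ε-map-suc {k = suc k} (x ∷ v) =
    *-cong (∏-cong {k} (λ r → reflexive (cong (σ (suc x)) (lookup-map r suc v)))) (ε-map-suc v)

  ε-allFin : ∀ k → ε (allFin k) ≈ 1#
  ε-allFin zero    = refl
  ε-allFin (suc k) = begin
    ε (allFin (suc k))
      ≡⟨ cong (λ v → ε {suc k} (zero ∷ v)) (tabulate-∘ suc id) ⟩
    Πσ zero (map suc (allFin k)) * ε (map suc (allFin k))
      ≈⟨ *-cong (Πσ-zero-map-suc (allFin k)) (trans (ε-map-suc (allFin k)) (ε-allFin k)) ⟩
    1# * 1#
      ≈⟨ *-identityˡ 1# ⟩
    1# ∎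

  -- The Leibniz formula, summed over all k-tuples f rather than over permutations:
  -- ε vanishes on the non-injective ones.
  det : ∀ {k} → Matrix k k → Carrier
  det {k} X = ∑ᵛ k (λ f → ε f * ∏ (λ i → X i (lookup f i)))

  det-cong : ∀ {k} {X Y : Matrix k k} → (∀ i j → X i j ≈ Y i j) → det X ≈ det Y
  det-cong {k} X≈Y = ∑ᵛ-cong k (λ f → *-congˡ (∏-cong {k} (λ i → X≈Y i (lookup f i))))

  det-identity : ∀ k → det (identity {k}) ≈ 1#
  det-identity k = begin
    ∑ᵛ k (λ f → ε f * ∏ (λ i → identity i (lookup f i)))
      ≈⟨ ∑ᵛ-cong k (λ f → trans (*-comm _ _) (*-congʳ (∏-cong {k} (λ i →
           reflexive (cong (λ r → identity r (lookup f i)) (≡.sym (lookup-allFin i))))))) ⟩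
    ∑ᵛ k (λ f → ∏ (λ i → identity (lookup (allFin k) i) (lookup f i)) * ε f)
      ≈⟨ ∑ᵛ-identity (allFin k) ε ⟩
    ε (allFin k)
      ≈⟨ ε-allFin k ⟩
    1# ∎

  -- Pairing f with its composite with the transposition (i j) would only give 2 · det X ≈ 0#.
  -- Instead the sum is split by the values a, b of f at i and j, which yields an alternating H.
  det-equal-rows : ∀ {k} (X : Matrix k k) {i j} → i ≢ j → (∀ c → X i c ≈ X j c) → det X ≈ 0#
  det-equal-rows {suc zero} X {zero} {zero} i≢j _ = contradiction ≡.refl i≢j
  det-equal-rows {suc (suc k)} X {i} {j} i≢j Xᵢ≈Xⱼ = begin
    det X
      ≈⟨ ∑ᵛ-insertAt i F ⟩
    ∑[ a < K ] ∑ᵛ (suc k) (λ h → F (insertAt h i a))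
      ≈⟨ sum-cong-≋ {K} (λ a → ∑ᵛ-insertAt j′ (λ h → F (insertAt h i a))) ⟩
    ∑[ a < K ] ∑[ b < K ] H a b
      ≈⟨ ∑∑-alternating≈0 H Hₐₐ≈0 Hₐᵦ+Hᵦₐ≈0 ⟩
    0# ∎
    where
    K = suc (suc k)
    j′ = punchOut i≢j
    F : Vec (Fin K) K → Carrier
    F f = ε f * ∏ (λ r → X r (lookup f r))
    H : Matrix K K
    H a b = ∑ᵛ k (λ h → F (insertAt (insertAt h j′ b) i a))
    Hₐₐ≈0 : ∀ a → H a a ≈ 0#
    Hₐₐ≈0 a = ∑ᵛ-zero k (λ h → trans (*-congʳ (ε-insertAt₂-diag h i j′ a)) (zeroˡ _))
    Xᵢ≈Xⱼ′ : ∀ c → X i c ≈ X (punchIn i j′) c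
    Xᵢ≈Xⱼ′ c = trans (Xᵢ≈Xⱼ c) (reflexive (cong (λ r → X r c) (≡.sym (punchIn-punchOut i≢j))))
    Hₐᵦ+Hᵦₐ≈0 : ∀ a b → H a b + H b a ≈ 0#
    Hₐᵦ+Hᵦₐ≈0 a b = begin
      H a b + H b a
        ≈⟨ sym (∑ᵛ-distrib-+ k _ _) ⟩
      ∑ᵛ k (λ h → F (insertAt (insertAt h j′ b) i a) + F (insertAt (insertAt h j′ a) i b))
        ≈⟨ ∑ᵛ-cong k (λ h → +-congˡ (*-congˡ (sym (∏-insertAt₂-swap X h i j′ a b Xᵢ≈Xⱼ′)))) ⟩
      ∑ᵛ k (λ h → ε (insertAt (insertAt h j′ b) i a) * P h + ε (insertAt (insertAt h j′ a) i b) * P h)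
        ≈⟨ ∑ᵛ-zero k (λ h → trans (sym (distribʳ _ _ _))
                                  (trans (*-congʳ (ε-insertAt₂-swap h i j′ a b)) (zeroˡ _))) ⟩
      0# ∎
      where
      P : Vec (Fin K) k → Carrier
      P h = ∏ (λ r → X r (lookup (insertAt (insertAt h j′ b) i a) r))

  det-· : ∀ {k m} (A : Matrix k m) (B : Matrix m k) →
          det (A · B) ≈ ∑ᵛ k (λ g → ∏ (λ a → A a (lookup g a)) * det (λ a → B (lookup g a)))
  det-· {k} {m} A B = begin
    ∑ᵛ k (λ f → ε f * ∏ (λ a → ∑[ w < m ] (A a w * B w (lookup f a))))
      ≈⟨ ∑ᵛ-cong k (λ f → *-congˡ (∏-∑-distrib k (λ a w → A a w * B w (lookup f a)))) ⟩
    ∑ᵛ k (λ f → ε f * ∑ᵛ k (λ g → ∏ (λ a → A a (lookup g a) * B (lookup g a) (lookup f a))))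
      ≈⟨ ∑ᵛ-cong k (λ f → *-distribˡ-∑ᵛ k _ _) ⟩
    ∑ᵛ k (λ f → ∑ᵛ k (λ g → ε f * ∏ (λ a → A a (lookup g a) * B (lookup g a) (lookup f a))))
      ≈⟨ ∑ᵛ-comm k k _ ⟩
    ∑ᵛ k (λ g → ∑ᵛ k (λ f → ε f * ∏ (λ a → A a (lookup g a) * B (lookup g a) (lookup f a))))
      ≈⟨ ∑ᵛ-cong k (λ g → ∑ᵛ-cong k (λ f → trans (*-congˡ (∏-distrib-* {k} _ _))
           (solve 3 (λ e x y → e ⊕ (x ⊕ y) ⊜ x ⊕ (e ⊕ y)) refl _ _ _))) ⟩
    ∑ᵛ k (λ g → ∑ᵛ k (λ f → ∏ (λ a → A a (lookup g a)) * (ε f * ∏ (λ a → B (lookup g a) (lookup f a)))))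
      ≈⟨ ∑ᵛ-cong k (λ g → sym (*-distribˡ-∑ᵛ k _ _)) ⟩
    ∑ᵛ k (λ g → ∏ (λ a → A a (lookup g a)) * det (λ a → B (lookup g a))) ∎

  det-rowSelection≈0 : ∀ {k m} → m < k → (B : Matrix m k) (g : Vec (Fin m) k) →
                       det (λ a → B (lookup g a)) ≈ 0#
  det-rowSelection≈0 m<k B g with pigeonhole m<k (lookup g)
  ... | i , j , i<j , gᵢ≡gⱼ =
    det-equal-rows _ (<⇒≢ i<j) (λ c → reflexive (cong (λ r → B r c) gᵢ≡gⱼ))

  ·≈identity⇒≤ : ∀ {k m} → ¬ (1# ≈ 0#) → (A : Matrix k m) (B : Matrix m k) →
                 (∀ a b → (A · B) a b ≈ identity a b) → k ≤ m
  ·≈identity⇒≤ {k} 1≉0 A B A·B≈I = ≮⇒≥ λ m<k → 1≉0 (begin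
    1#                  ≈⟨ sym (det-identity k) ⟩
    det (identity {k})  ≈⟨ sym (det-cong A·B≈I) ⟩
    det (A · B)         ≈⟨ det-· A B ⟩
    ∑ᵛ k (λ g → ∏ (λ a → A a (lookup g a)) * det (λ a → B (lookup g a)))
      ≈⟨ ∑ᵛ-zero k (λ g → trans (*-congˡ (det-rowSelection≈0 m<k B g)) (zeroʳ _)) ⟩
    0#                  ∎)

module Orthonormal {c ℓ} (R : StarRing c ℓ) where
  open StarRing R hiding (zero)
  open Determinant commRing using (identity; identity-element; ·≈identity⇒≤)
  open import Algebra.Properties.Semiring.Sum semiring using (sum; sum-syntax)
  open import Relation.Binary.Reasoning.Setoid setoid

  sumFin≡sum : ∀ n (f : Fin n → Carrier) → sumFin R n f ≡ sum f
  sumFin≡sum zero    f = ≡.refl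
  sumFin≡sum (suc n) f = cong (f zero +_) (sumFin≡sum n (f ∘ suc))

  δ≡identity : ∀ {n} (i j : Fin n) → δ R i j ≡ identity i j
  δ≡identity zero    zero    = ≡.refl
  δ≡identity zero    (suc j) = ≡.refl
  δ≡identity (suc i) zero    = ≡.refl
  δ≡identity (suc i) (suc j) = δ≡identity i j

  orthonormal-rows⇒≤ : ∀ {n m} (U : Fin n → Fin m → Carrier) →
                       (∀ i j → sumFin R m (λ k → U i k * conj (U j k)) ≈ δ R i j) →
                       (S : Subset n) (T : Subset m) → (∀ v w → v ∈ S → w ∉ T → U v w ≈ 0#) →
                       ∣ S ∣ ≤ ∣ T ∣
  orthonormal-rows⇒≤ {m = m} U rows S T U-vanishes =
    ·≈identity⇒≤ nontrivial (λ a x → U (s a) (t x)) (λ x b → conj (U (s b) (t x))) orthonormal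
    where
    s = element S
    t = element T
    orthonormal : ∀ a b → ∑[ x < ∣ T ∣ ] (U (s a) (t x) * conj (U (s b) (t x))) ≈ identity a b
    orthonormal a b = begin
      ∑[ x < ∣ T ∣ ] (U (s a) (t x) * conj (U (s b) (t x)))
        ≈⟨ sym (∑-restrict +-monoid T _ λ w w∉T →
                  trans (*-congʳ (U-vanishes _ w (element-∈ S a) w∉T)) (zeroˡ _)) ⟩
      ∑[ w < m ] (U (s a) w * conj (U (s b) w))
        ≡⟨ sumFin≡sum m _ ⟨
      sumFin R m (λ w → U (s a) w * conj (U (s b) w))
        ≈⟨ rows (s a) (s b) ⟩
      δ R (s a) (s b)
        ≡⟨ δ≡identity (s a) (s b) ⟩
      identity (s a) (s b)
        ≡⟨ identity-element S a b ⟩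
      identity a b ∎

∈-N : ∀ {n} (A : Fin n → Fin n → Bool) (S : Subset n) {v w} → v ∈ S → A v w ≡ true → w ∈ N A S
∈-N {n} A S {v} {w} v∈S arc = lookup⇒[]= w (N A S) (≡.trans (lookup∘tabulate _ w) any≡true)
  where
  any≡true : any (λ u → lookup S u ∧ A u w) (allFinᴸ n) ≡ true
  any≡true = Equivalence.to T-≡
    (any⁺ _ (lose (∈-allFin v) (Equivalence.from T-≡ (cong₂ _∧_ ([]=⇒lookup v∈S) arc))))

¬¬-∀-Fin : ∀ {p n} {P : Fin n → Set p} → (∀ i → ¬ ¬ P i) → ¬ ¬ (∀ i → P i)
¬¬-∀-Fin {n = zero}  _   k = k (λ ())
¬¬-∀-Fin {n = suc n} ¬¬P k = ¬¬P zero λ P₀ → ¬¬-∀-Fin (¬¬P ∘ suc) λ Pₛ → k (∀-cons P₀ Pₛ)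

-- Off the arcs the support hypothesis gives only ¬ ¬ (U v w ≈ 0#); the double negation is
-- discharged because the conclusion is decidable.
mainTheorem11 : {c ℓ : Level} (R : StarRing c ℓ) (n : ℕ)
    (A : Fin n → Fin n → Bool) → Symmetric A → InU R A →
    (S : Subset n) → ∣ S ∣ ≤ ∣ N A S ∣
mainTheorem11 R n A _ (U , (rows , _) , support) S =
  decidable-stable (∣ S ∣ ≤? ∣ N A S ∣)
    (¬¬-map bound (¬¬-∀-Fin λ v → ¬¬-∀-Fin (vanishes-off-arcs v)))
  where
  open StarRing R using (_≈_; 0#)
  vanishes-off-arcs : ∀ v w → ¬ ¬ (¬ A v w ≡ true → U v w ≈ 0#)
  vanishes-off-arcs v w k =
    k λ ¬arc → ⊥-elim (¬arc (Equivalence.to (support v w) λ U≈0 → k λ _ → U≈0))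
  bound : (∀ v w → ¬ A v w ≡ true → U v w ≈ 0#) → ∣ S ∣ ≤ ∣ N A S ∣
  bound U-vanishes = Orthonormal.orthonormal-rows⇒≤ R U rows S (N A S)
    λ v w v∈S w∉NS → U-vanishes v w (w∉NS ∘ ∈-N A S v∈S)
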